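{- If $S$ is a strongly connected component of the pair-digraph $G^+$, then $S'=\{(u,v):(v,u)\in S\}$ is also a strongly connected component of $G^+$.
   Context: $G$ is a graph with a given partition of $V(G)$ into independent sets (partite sets) $V_1,\dots,V_k$; $c(u)$ denotes the index of the partite set containing $u$. Let $\bar E=\{uv: u\in V_i, v\in V_j, i\neq j\}\setminus E(G)$. The pair-digraph $G^+$ has vertex set all ordered pairs $(u,v)$ with $u,v\in V(G)$, $u\ne v$, and arcs: (i) $(u,v)\to(u',v)$ whenever $c(u)=c(v)$, $uu'\in E(G)$, $vu'\notin E(G)$; (ii) $(u,v)\to(u',v)$ whenever $uu'\in E(G)$, $u'v\in\bar E$, and $u,v,u'$ lie in three different partite sets; (iii) $(u,v)\to(u,v')$ whenever $c(u)=c(v')$, $vv'\in E(G)$, $uv\notin E(G)$; (iv) $(u,v)\to(u,v')$ whenever $vv'\in E(G)$, $uv\in\bar E$, and $u,v,v'$ lie in three different partite sets. -}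

module Defs where

open import Data.Nat using (ℕ)
open import Data.Fin using (Fin)
open import Data.Product using (_×_; _,_; ∃)
open import Relation.Nullary using (¬_)
open import Relation.Binary.PropositionalEquality using (_≡_; _≢_)
open import Relation.Binary.Construct.Closure.ReflexiveTransitive using (Star)
open import Level using (0ℓ)

-- A finite simple graph on vertex set Fin n together with a partition of
-- the vertex set into k independent sets (partite sets); c u is the index of
-- the partite set containing u.
record MultipartiteGraph : Set₁ where
  field
    n     : ℕ
    k     : ℕ
    E     : Fin n → Fin n → Set
    E-sym : ∀ {u v} → E u v → E v u
    E-irr : ∀ {u} → ¬ E u u
    c     : Fin n → Fin k
    indep : ∀ {u v} → E u v → c u ≢ c v

module PairDigraph (G : MultipartiteGraph) where
  open MultipartiteGraph G

  V : Set
  V = Fin n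

  Ebar : V → V → Set
  Ebar u v = c u ≢ c v × ¬ E u v

  ThreeParts : V → V → V → Set
  ThreeParts x y z = c x ≢ c y × c x ≢ c z × c y ≢ c z

  Pair : Set
  Pair = V × V

  -- vertices of G⁺ : ordered pairs of distinct vertices
  Valid : Pair → Set
  Valid (u , v) = u ≢ v

  data Rule : Pair → Pair → Set where
    r1 : ∀ {u v u'} → c u ≡ c v → E u u' → ¬ E v u' → Rule (u , v) (u' , v)
    r2 : ∀ {u v u'} → E u u' → Ebar u' v → ThreeParts u v u' → Rule (u , v) (u' , v)
    r3 : ∀ {u v v'} → c u ≡ c v' → E v v' → ¬ E u v → Rule (u , v) (u , v')
    r4 : ∀ {u v v'} → E v v' → Ebar u v → ThreeParts u v v' → Rule (u , v) (u , v')

  Arc : Pair → Pair → Set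
  Arc p q = Valid p × Valid q × Rule p q

  Reach : Pair → Pair → Set
  Reach = Star Arc

  PairSet : Set₁
  PairSet = Pair → Set

  record IsSCC (S : PairSet) : Set where
    field
      valid    : ∀ {p} → S p → Valid p
      nonempty : ∃ S
      strong   : ∀ {p q} → S p → S q → Reach p q
      maximal  : ∀ {p q} → S p → Valid q → Reach p q → Reach q p → S q

  reverse : PairSet → PairSet
  reverse S (u , v) = S (v , u)

{-# OPTIONS --safe #-}
module Submission where

open import Defs
open import Data.Product using (_,_; swap)
open import Function using (id; _∘_)
open import Relation.Binary.PropositionalEquality using (sym; ≢-sym)
open import Relation.Binary.Construct.Closure.ReflexiveTransitive as Star using ()

-- Swapping coordinates reverses every arc of G⁺ (it exchanges rules (i)/(iii)
-- and (ii)/(iv), since E and Ebar are symmetric), so it maps walks to reversed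
-- walks and hence SCCs to SCCs.
module _ (G : MultipartiteGraph) where
  open MultipartiteGraph G
  open PairDigraph G

  Valid-swap : ∀ {p} → Valid p → Valid (swap p)
  Valid-swap = ≢-sym

  Ebar-sym : ∀ {u v} → Ebar u v → Ebar v u
  Ebar-sym (cu≢cv , ¬uv) = ≢-sym cu≢cv , ¬uv ∘ E-sym

  Rule-reverse : ∀ {p q} → Rule p q → Rule (swap q) (swap p)
  Rule-reverse (r1 cu≡cv uu' ¬vu') = r3 (sym cu≡cv) (E-sym uu') ¬vu'
  Rule-reverse (r2 uu' u'v (cu≢cv , cu≢cu' , cv≢cu')) =
    r4 (E-sym uu') (Ebar-sym u'v) (cv≢cu' , ≢-sym cu≢cv , ≢-sym cu≢cu')
  Rule-reverse (r3 cu≡cv' vv' ¬uv) = r1 (sym cu≡cv') (E-sym vv') ¬uv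
  Rule-reverse (r4 vv' uv (cu≢cv , cu≢cv' , cv≢cv')) =
    r2 (E-sym vv') (Ebar-sym uv) (≢-sym cu≢cv' , ≢-sym cv≢cv' , cu≢cv)

  Arc-reverse : ∀ {p q} → Arc p q → Arc (swap q) (swap p)
  Arc-reverse (vp , vq , rule) = Valid-swap vq , Valid-swap vp , Rule-reverse rule

  Reach-reverse : ∀ {p q} → Reach p q → Reach (swap q) (swap p)
  Reach-reverse = Star.gmap swap id ∘ Star.reverse Arc-reverse

  IsSCC-reverse : (S : PairSet) → IsSCC S → IsSCC (reverse S)
  IsSCC-reverse S scc = record
    { valid    = Valid-swap ∘ valid
    ; nonempty = let (p , s) = nonempty in swap p , s
    ; strong   = λ s s' → Reach-reverse (strong s' s)
    ; maximal  = λ s vq pq qp →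
        maximal s (Valid-swap vq) (Reach-reverse qp) (Reach-reverse pq)
    }
    where open IsSCC scc

lemma2 : (G : MultipartiteGraph) → let open PairDigraph G in
         (S : PairSet) → IsSCC S → IsSCC (reverse S)
lemma2 = IsSCC-reverse
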